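{- Let $a$ and $m$ be positive integers and $f_0(n)=\binom{n+a-2}{a-1}$ for $n=1,2,\ldots$. For $n\ge1$, $f_m(n)$ equals the number of words of length $n-1$ over the alphabet $\{0,1,\ldots,a+m-1\}$ satisfying property $\mathcal P_2$.
   Context: For an arithmetic function $f_0$ defined on the positive integers, define recursively for $m\ge 1$: $c_m(n,k)=\sum_{i_1+\cdots+i_k=n} f_{m-1}(i_1)\cdots f_{m-1}(i_k)$, the sum over all $k$-tuples of positive integers with sum $n$, and $f_m(n)=\sum_{k=1}^n c_m(n,k)$. A word satisfies property $\mathcal P_2$ if every maximal factor (block of consecutive letters) consisting only of letters from $\{0,1,\ldots,a-1\}$ has no rises, i.e. no two consecutive letters $x,y$ in the block with $x<y$. -}

module Defs where

open import Data.Nat using (ℕ; zero; suc; _+_; _*_; _∸_; _<_; _<?_; _≟_)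
open import Data.Nat.Combinatorics using (_C_)
open import Data.Fin using (Fin; toℕ)
open import Data.List using (List; []; _∷_; [_]; map; concatMap; upTo; allFin; length; filter; zip)
open import Data.Nat.ListAction using (sum; product)
open import Data.List.Relation.Unary.All using (All; all?)
open import Data.Vec using (Vec; toList) renaming ([] to []ᵥ; _∷_ to _∷ᵥ_)
open import Data.Product using (_×_; _,_)
open import Relation.Nullary using (¬_; Dec; yes; no; ¬?; _→-dec_)

compositions : ℕ → ℕ → List (List ℕ)
compositions n zero with n ≟ 0
... | yes _ = [ [] ]
... | no  _ = []
compositions n (suc k) =
  concatMap (λ i → map (suc i ∷_) (compositions (n ∸ suc i) k)) (upTo n)

c : (ℕ → ℕ) → ℕ → ℕ → ℕ
c g n k = sum (map (λ t → product (map g t)) (compositions n k))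

f : (ℕ → ℕ) → ℕ → ℕ → ℕ
f f₀ zero n = f₀ n
f f₀ (suc m) n = sum (map (λ i → c (f f₀ m) n (suc i)) (upTo n))

f₀ : ℕ → ℕ → ℕ
f₀ a n = (n + a ∸ 2) C (a ∸ 1)

words : (k n : ℕ) → List (Vec (Fin k) n)
words k zero = [ []ᵥ ]
words k (suc n) = concatMap (λ x → map (x ∷ᵥ_) (words k n)) (allFin k)

adjacent : {A : Set} → List A → List (A × A)
adjacent [] = []
adjacent (x ∷ xs) = zip (x ∷ xs) xs

-- A pair of consecutive letters (x,y) lies inside a block of letters from
-- {0,…,a-1} iff x < a and y < a; it is a rise iff x < y.
NoRiseInBlock : ℕ → {k : ℕ} → Fin k × Fin k → Set
NoRiseInBlock a (x , y) = toℕ x < a → toℕ y < a → ¬ (toℕ x < toℕ y)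

-- property P₂: no maximal factor over {0,…,a-1} contains a rise
P₂ : ℕ → {k n : ℕ} → Vec (Fin k) n → Set
P₂ a w = All (NoRiseInBlock a) (adjacent (toList w))

P₂? : (a : ℕ) {k n : ℕ} (w : Vec (Fin k) n) → Dec (P₂ a w)
P₂? a w = all? (λ { (x , y) → (toℕ x <? a) →-dec ((toℕ y <? a) →-dec ¬? (toℕ x <? toℕ y)) })
               (adjacent (toList w))

countP₂ : (a k n : ℕ) → ℕ
countP₂ a k n = length (filter (P₂? a) (words k n))

-- A P₂-word over {0,…,a+m} either avoids the top letter a+m, or splits at its
-- first occurrence into a P₂-word over {0,…,a+m-1}, the top letter, and an
-- arbitrary P₂-word over {0,…,a+m}: the top letter lies outside every block, so
-- it never creates a rise.  Writing W_K(L) for the number of P₂-words of length L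
-- over K letters, this gives the renewal equation
--   W_{K+1}(L) = W_K(L) + Σ_{i<L} W_K(i) · W_{K+1}(L-1-i).
-- Splitting off the first part of a composition shows that u(L) = f_{m+1}(L+1)
-- satisfies the same equation with W_K(i) replaced by f_m(i+1), and a renewal
-- equation determines its solution.  The induction on m starts from
-- W_a(L) = C(L+a-1, a-1), the number of non-increasing words of length L over a
-- letters (hockey-stick identity).
module Submission where

open import Defs
open import Data.Bool using (true; false; if_then_else_)
open import Data.Fin using (Fin; toℕ)
open import Data.List using (List; []; _∷_; _++_; map; concatMap; upTo; applyUpTo; allFin; tabulate; length; filter)
open import Data.List.Properties using (map-++; map-∘; map-tabulate)
open import Data.Nat using (ℕ; zero; suc; _+_; _*_; _∸_; _≤_; _<_; s≤s; z≤n; _<?_)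
open import Data.Nat.Combinatorics using (_C_; nCn≡1; nCk+nC[k+1]≡[n+1]C[k+1])
open import Data.Nat.Induction using (<-rec)
open import Data.Nat.ListAction using (sum; product)
open import Data.Nat.ListAction.Properties using (sum-++)
open import Data.Nat.Properties
open import Data.Vec using (Vec) renaming ([] to []ᵥ; _∷_ to _∷ᵥ_)
open import Data.Empty using (⊥-elim)
open import Function using (_∘_)
open import Relation.Nullary using (Dec; does; _because_; invert; ¬_; ¬?; _→-dec_; _×-dec_)
open import Relation.Binary.PropositionalEquality
open import Algebra.Properties.CommutativeSemigroup +-commutativeSemigroup using () renaming (interchange to +-interchange)
open ≡-Reasoning

-- Finite sums

sumTo : ℕ → (ℕ → ℕ) → ℕ
sumTo zero    h = 0
sumTo (suc n) h = h 0 + sumTo n (h ∘ suc)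

syntax sumTo n (λ i → e) = ∑[ i < n ] e

sumTo-cong : ∀ n {h k : ℕ → ℕ} → (∀ i → i < n → h i ≡ k i) → sumTo n h ≡ sumTo n k
sumTo-cong zero    eq = refl
sumTo-cong (suc n) eq = cong₂ _+_ (eq 0 (s≤s z≤n)) (sumTo-cong n (λ i i<n → eq (suc i) (s≤s i<n)))

sumTo-zero : ∀ n {h : ℕ → ℕ} → (∀ i → i < n → h i ≡ 0) → sumTo n h ≡ 0
sumTo-zero zero    eq = refl
sumTo-zero (suc n) eq = cong₂ _+_ (eq 0 (s≤s z≤n)) (sumTo-zero n (λ i i<n → eq (suc i) (s≤s i<n)))

sumTo-distrib-+ : ∀ n (h k : ℕ → ℕ) → ∑[ i < n ] (h i + k i) ≡ sumTo n h + sumTo n k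
sumTo-distrib-+ zero    h k = refl
sumTo-distrib-+ (suc n) h k =
  trans (cong (h 0 + k 0 +_) (sumTo-distrib-+ n (h ∘ suc) (k ∘ suc))) (+-interchange (h 0) (k 0) _ _)

sumTo-distribˡ : ∀ n c (h : ℕ → ℕ) → ∑[ i < n ] (c * h i) ≡ c * sumTo n h
sumTo-distribˡ zero    c h = sym (*-zeroʳ c)
sumTo-distribˡ (suc n) c h =
  trans (cong (c * h 0 +_) (sumTo-distribˡ n c (h ∘ suc))) (sym (*-distribˡ-+ c (h 0) _))

sumTo-distribʳ : ∀ n c (h : ℕ → ℕ) → ∑[ i < n ] (h i * c) ≡ sumTo n h * c
sumTo-distribʳ n c h =
  trans (sumTo-cong n (λ i _ → *-comm (h i) c)) (trans (sumTo-distribˡ n c h) (*-comm c _))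

sumTo-comm : ∀ m n (h : ℕ → ℕ → ℕ) → ∑[ i < m ] sumTo n (h i) ≡ ∑[ j < n ] ∑[ i < m ] h i j
sumTo-comm zero    n h = sym (sumTo-zero n (λ _ _ → refl))
sumTo-comm (suc m) n h = begin
  sumTo n (h 0) + ∑[ i < m ] sumTo n (h (suc i))   ≡⟨ cong (sumTo n (h 0) +_) (sumTo-comm m n (h ∘ suc)) ⟩
  sumTo n (h 0) + ∑[ j < n ] ∑[ i < m ] h (suc i) j ≡⟨ sumTo-distrib-+ n (h 0) _ ⟨
  ∑[ j < n ] (h 0 j + ∑[ i < m ] h (suc i) j)       ∎

sumTo-snoc : ∀ n (h : ℕ → ℕ) → sumTo (suc n) h ≡ sumTo n h + h n
sumTo-snoc zero    h = +-comm (h 0) 0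
sumTo-snoc (suc n) h = trans (cong (h 0 +_) (sumTo-snoc n (h ∘ suc))) (sym (+-assoc (h 0) _ _))

sumTo-split : ∀ m n (h : ℕ → ℕ) → sumTo (m + n) h ≡ sumTo m h + ∑[ i < n ] h (m + i)
sumTo-split zero    n h = refl
sumTo-split (suc m) n h = trans (cong (h 0 +_) (sumTo-split m n (h ∘ suc))) (sym (+-assoc (h 0) _ _))

sum-map-concatMap : {A B : Set} (h : B → ℕ) (g : A → List B) (xs : List A) →
  sum (map h (concatMap g xs)) ≡ sum (map (λ x → sum (map h (g x))) xs)
sum-map-concatMap h g []       = refl
sum-map-concatMap h g (x ∷ xs) = begin
  sum (map h (g x ++ concatMap g xs))
    ≡⟨ cong sum (map-++ h (g x) _) ⟩
  sum (map h (g x) ++ map h (concatMap g xs))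
    ≡⟨ sum-++ (map h (g x)) _ ⟩
  sum (map h (g x)) + sum (map h (concatMap g xs))
    ≡⟨ cong (sum (map h (g x)) +_) (sum-map-concatMap h g xs) ⟩
  sum (map h (g x)) + sum (map (λ x → sum (map h (g x))) xs) ∎

sum-map-cong : {A : Set} {h k : A → ℕ} → (∀ x → h x ≡ k x) → (xs : List A) →
  sum (map h xs) ≡ sum (map k xs)
sum-map-cong eq []       = refl
sum-map-cong eq (x ∷ xs) = cong₂ _+_ (eq x) (sum-map-cong eq xs)

sum-map-distribˡ : {A : Set} (c : ℕ) (h : A → ℕ) (xs : List A) →
  sum (map (λ x → c * h x) xs) ≡ c * sum (map h xs)
sum-map-distribˡ c h []       = sym (*-zeroʳ c)
sum-map-distribˡ c h (x ∷ xs) =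
  trans (cong (c * h x +_) (sum-map-distribˡ c h xs)) (sym (*-distribˡ-+ c (h x) _))

sum-map-applyUpTo : ∀ n (g h : ℕ → ℕ) → sum (map h (applyUpTo g n)) ≡ ∑[ i < n ] h (g i)
sum-map-applyUpTo zero    g h = refl
sum-map-applyUpTo (suc n) g h = cong (h (g 0) +_) (sum-map-applyUpTo n (g ∘ suc) h)

sum-map-upTo : ∀ n (h : ℕ → ℕ) → sum (map h (upTo n)) ≡ sumTo n h
sum-map-upTo n = sum-map-applyUpTo n (λ i → i)

sum-tabulate : ∀ n (h : ℕ → ℕ) → sum (tabulate {n = n} (h ∘ toℕ)) ≡ sumTo n h
sum-tabulate zero    h = refl
sum-tabulate (suc n) h = cong (h 0 +_) (sum-tabulate n (h ∘ suc))

sum-map-allFin : ∀ n (h : ℕ → ℕ) → sum (map (h ∘ toℕ) (allFin n)) ≡ sumTo n h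
sum-map-allFin n h = trans (cong sum (map-tabulate {n = n} (λ i → i) (h ∘ toℕ))) (sum-tabulate n h)

𝟙 : {P : Set} → Dec P → ℕ
𝟙 d = if does d then 1 else 0

𝟙-yes : {P : Set} (d : Dec P) → P → 𝟙 d ≡ 1
𝟙-yes (true  because _) _ = refl
𝟙-yes (false because [¬p]) p = ⊥-elim (invert [¬p] p)

𝟙-no : {P : Set} (d : Dec P) → ¬ P → 𝟙 d ≡ 0
𝟙-no (false because _) _ = refl
𝟙-no (true  because [p]) ¬p = ⊥-elim (¬p (invert [p]))

𝟙-×-dec : {P Q : Set} (d : Dec P) (e : Dec Q) → 𝟙 (d ×-dec e) ≡ 𝟙 d * 𝟙 e
𝟙-×-dec d e with does d
... | true  = sym (+-identityʳ (𝟙 e))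
... | false = refl

length-filter≡sum-𝟙 : {A : Set} {P : A → Set} (P? : (x : A) → Dec (P x)) (xs : List A) →
  length (filter P? xs) ≡ sum (map (𝟙 ∘ P?) xs)
length-filter≡sum-𝟙 P? []       = refl
length-filter≡sum-𝟙 P? (x ∷ xs) with does (P? x)
... | true  = cong suc (length-filter≡sum-𝟙 P? xs)
... | false = length-filter≡sum-𝟙 P? xs

-- Renewal equations

IsRenewal : (V u : ℕ → ℕ) → Set
IsRenewal V u = ∀ L → u L ≡ V L + ∑[ i < L ] (V i * u (L ∸ suc i))

renewal-unique : ∀ {V V′ u v : ℕ → ℕ} → (∀ L → V L ≡ V′ L) →
  IsRenewal V u → IsRenewal V′ v → ∀ L → u L ≡ v L
renewal-unique {V} {V′} {u} {v} V≗V′ u-renewal v-renewal = <-rec _ step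
  where
  step : ∀ L → (∀ {j} → j < L → u j ≡ v j) → u L ≡ v L
  step L ih = begin
    u L                                      ≡⟨ u-renewal L ⟩
    V L + ∑[ i < L ] (V i * u (L ∸ suc i))     ≡⟨ cong₂ _+_ (V≗V′ L) (sumTo-cong L same-terms) ⟩
    V′ L + ∑[ i < L ] (V′ i * v (L ∸ suc i))   ≡⟨ v-renewal L ⟨
    v L                                      ∎
    where
    same-terms : ∀ i → i < L → V i * u (L ∸ suc i) ≡ V′ i * v (L ∸ suc i)
    same-terms i i<L = cong₂ _*_ (V≗V′ i) (ih (∸-monoʳ-< (s≤s z≤n) i<L))

-- Compositions

c-suc : ∀ g n k → c g n (suc k) ≡ ∑[ i < n ] (g (suc i) * c g (n ∸ suc i) k)
c-suc g n k = begin
  sum (map weight (concatMap (λ i → map (suc i ∷_) (compositions (n ∸ suc i) k)) (upTo n)))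
    ≡⟨ sum-map-concatMap weight _ (upTo n) ⟩
  sum (map (λ i → sum (map weight (map (suc i ∷_) (compositions (n ∸ suc i) k)))) (upTo n))
    ≡⟨ sum-map-cong first-part (upTo n) ⟩
  sum (map (λ i → g (suc i) * c g (n ∸ suc i) k) (upTo n))
    ≡⟨ sum-map-upTo n _ ⟩
  ∑[ i < n ] (g (suc i) * c g (n ∸ suc i) k) ∎
  where
  weight : List ℕ → ℕ
  weight t = product (map g t)
  first-part : ∀ i → sum (map weight (map (suc i ∷_) (compositions (n ∸ suc i) k)))
                     ≡ g (suc i) * c g (n ∸ suc i) k
  first-part i = trans (cong sum (sym (map-∘ (compositions (n ∸ suc i) k))))
                       (sum-map-distribˡ (g (suc i)) weight (compositions (n ∸ suc i) k))

c-vanishes : ∀ g {j k} → j < k → c g j k ≡ 0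
c-vanishes g {j} {suc k} (s≤s j≤k) = trans (c-suc g j k) (sumTo-zero j vanishing-terms)
  where
  vanishing-terms : ∀ i → i < j → g (suc i) * c g (j ∸ suc i) k ≡ 0
  vanishing-terms i i<j = trans (cong (g (suc i) *_) (c-vanishes g (<-≤-trans (∸-monoʳ-< (s≤s z≤n) i<j) j≤k)))
                                (*-zeroʳ (g (suc i)))

compositionSum : (ℕ → ℕ) → ℕ → ℕ
compositionSum g n = ∑[ k < n ] c g n (suc k)

f-suc : ∀ g m n → f g (suc m) n ≡ compositionSum (f g m) n
f-suc g m n = sum-map-upTo n _

sum-c : ∀ g {j n} → j ≤ n → ∑[ k < suc n ] c g j k ≡ c g j 0 + compositionSum g j
sum-c g {j} {n} j≤n = cong (c g j 0 +_) (begin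
  ∑[ k < n ] c g j (suc k)
    ≡⟨ cong (λ l → ∑[ k < l ] c g j (suc k)) (m+[n∸m]≡n j≤n) ⟨
  ∑[ k < j + (n ∸ j) ] c g j (suc k)
    ≡⟨ sumTo-split j (n ∸ j) _ ⟩
  compositionSum g j + ∑[ i < n ∸ j ] c g j (suc (j + i))
    ≡⟨ cong (compositionSum g j +_) (sumTo-zero (n ∸ j) (λ i _ → c-vanishes g (s≤s (m≤m+n j i)))) ⟩
  compositionSum g j + 0
    ≡⟨ +-identityʳ _ ⟩
  compositionSum g j ∎)

compositionSum-suc : ∀ g L →
  compositionSum g (suc L) ≡ ∑[ i < suc L ] (g (suc i) * (c g (L ∸ i) 0 + compositionSum g (L ∸ i)))
compositionSum-suc g L = begin
  ∑[ k < suc L ] c g (suc L) (suc k)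
    ≡⟨ sumTo-cong (suc L) (λ k _ → c-suc g (suc L) k) ⟩
  ∑[ k < suc L ] ∑[ i < suc L ] (g (suc i) * c g (L ∸ i) k)
    ≡⟨ sumTo-comm (suc L) (suc L) (λ k i → g (suc i) * c g (L ∸ i) k) ⟩
  ∑[ i < suc L ] ∑[ k < suc L ] (g (suc i) * c g (L ∸ i) k)
    ≡⟨ sumTo-cong (suc L) (λ i _ → sumTo-distribˡ (suc L) (g (suc i)) (c g (L ∸ i))) ⟩
  ∑[ i < suc L ] (g (suc i) * ∑[ k < suc L ] c g (L ∸ i) k)
    ≡⟨ sumTo-cong (suc L) (λ i _ → cong (g (suc i) *_) (sum-c g (m∸n≤m L i))) ⟩
  ∑[ i < suc L ] (g (suc i) * (c g (L ∸ i) 0 + compositionSum g (L ∸ i))) ∎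

-- c g j 0 is 1 for j = 0 and 0 otherwise, so besides the one-part composition
-- only the compositions with at least two parts remain.
compositionSum-renewal : ∀ g → IsRenewal (g ∘ suc) (compositionSum g ∘ suc)
compositionSum-renewal g L = begin
  compositionSum g (suc L)                 ≡⟨ compositionSum-suc g L ⟩
  sumTo (suc L) term                       ≡⟨ sumTo-snoc L term ⟩
  sumTo L term + term L                    ≡⟨ cong₂ _+_ (sumTo-cong L several-parts) one-part ⟩
  ∑[ i < L ] (g (suc i) * compositionSum g (suc (L ∸ suc i))) + g (suc L)
                                           ≡⟨ +-comm _ (g (suc L)) ⟩
  g (suc L) + ∑[ i < L ] (g (suc i) * compositionSum g (suc (L ∸ suc i))) ∎
  where
  term : ℕ → ℕ
  term i = g (suc i) * (c g (L ∸ i) 0 + compositionSum g (L ∸ i))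
  one-part : term L ≡ g (suc L)
  one-part = trans (cong (λ z → g (suc L) * (c g z 0 + compositionSum g z)) (n∸n≡0 L)) (*-identityʳ _)
  several-parts : ∀ i → i < L → term i ≡ g (suc i) * compositionSum g (suc (L ∸ suc i))
  several-parts i i<L = cong (λ z → g (suc i) * (c g z 0 + compositionSum g z)) (+-∸-assoc 1 i<L)

-- Counting words by a transfer matrix

-- Literally the test inside P₂?, so that 𝟙 (P₂? a w) unfolds to a product of allowed factors.
noRise? : (a x y : ℕ) → Dec (x < a → y < a → ¬ x < y)
noRise? a x y = (x <? a) →-dec ((y <? a) →-dec ¬? (x <? y))

allowed : (a x y : ℕ) → ℕ
allowed a x y = 𝟙 (noRise? a x y)

allowed-outsideˡ : ∀ a {x} y → a ≤ x → allowed a x y ≡ 1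
allowed-outsideˡ a y a≤x = 𝟙-yes (noRise? a _ y) (λ x<a → ⊥-elim (<⇒≱ x<a a≤x))

allowed-outsideʳ : ∀ a x {y} → a ≤ y → allowed a x y ≡ 1
allowed-outsideʳ a x a≤y = 𝟙-yes (noRise? a x _) (λ _ y<a → ⊥-elim (<⇒≱ y<a a≤y))

allowed-descent : ∀ a {x y} → y ≤ x → allowed a x y ≡ 1
allowed-descent a y≤x = 𝟙-yes (noRise? a _ _) (λ _ _ x<y → <⇒≱ x<y y≤x)

allowed-rise : ∀ {a x y} → x < a → y < a → x < y → allowed a x y ≡ 0
allowed-rise {a} x<a y<a x<y = 𝟙-no (noRise? a _ _) (λ noRise → noRise x<a y<a x<y)

weightAfter : ∀ a (x : ℕ) {K n} → Vec (Fin K) n → ℕ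
weightAfter a x []ᵥ      = 1
weightAfter a x (y ∷ᵥ w) = allowed a x (toℕ y) * weightAfter a (toℕ y) w

𝟙-P₂?-∷ : ∀ a {K n} (y : Fin K) (w : Vec (Fin K) n) → 𝟙 (P₂? a (y ∷ᵥ w)) ≡ weightAfter a (toℕ y) w
𝟙-P₂?-∷ a y []ᵥ      = refl
𝟙-P₂?-∷ a y (z ∷ᵥ w) =
  trans (𝟙-×-dec (noRise? a (toℕ y) (toℕ z)) (P₂? a (z ∷ᵥ w)))
        (cong (allowed a (toℕ y) (toℕ z) *_) (𝟙-P₂?-∷ a z w))

-- A virtual first letter a lies outside every block, so it imposes no condition.
𝟙-P₂? : ∀ a {K n} (w : Vec (Fin K) n) → 𝟙 (P₂? a w) ≡ weightAfter a a w
𝟙-P₂? a []ᵥ      = refl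
𝟙-P₂? a (y ∷ᵥ w) = begin
  𝟙 (P₂? a (y ∷ᵥ w))                          ≡⟨ 𝟙-P₂?-∷ a y w ⟩
  weightAfter a (toℕ y) w                     ≡⟨ *-identityˡ _ ⟨
  1 * weightAfter a (toℕ y) w                 ≡⟨ cong (_* weightAfter a (toℕ y) w) (allowed-outsideˡ a (toℕ y) ≤-refl) ⟨
  allowed a a (toℕ y) * weightAfter a (toℕ y) w ∎

wordsAfter : (a K L x : ℕ) → ℕ
wordsAfter a K zero    x = 1
wordsAfter a K (suc L) x = ∑[ y < K ] (allowed a x y * wordsAfter a K L y)

sum-weightAfter : ∀ a K L x → sum (map (weightAfter a x) (words K L)) ≡ wordsAfter a K L x
sum-weightAfter a K zero    x = refl
sum-weightAfter a K (suc L) x = begin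
  sum (map (weightAfter a x) (concatMap (λ y → map (y ∷ᵥ_) (words K L)) (allFin K)))
    ≡⟨ sum-map-concatMap (weightAfter a x) _ (allFin K) ⟩
  sum (map (λ y → sum (map (weightAfter a x) (map (y ∷ᵥ_) (words K L)))) (allFin K))
    ≡⟨ sum-map-cong first-letter (allFin K) ⟩
  sum (map (λ y → allowed a x (toℕ y) * wordsAfter a K L (toℕ y)) (allFin K))
    ≡⟨ sum-map-allFin K (λ y → allowed a x y * wordsAfter a K L y) ⟩
  ∑[ y < K ] (allowed a x y * wordsAfter a K L y) ∎
  where
  first-letter : ∀ y → sum (map (weightAfter a x) (map (y ∷ᵥ_) (words K L)))
                       ≡ allowed a x (toℕ y) * wordsAfter a K L (toℕ y)
  first-letter y = begin
    sum (map (weightAfter a x) (map (y ∷ᵥ_) (words K L)))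
      ≡⟨ cong sum (map-∘ (words K L)) ⟨
    sum (map (λ w → allowed a x (toℕ y) * weightAfter a (toℕ y) w) (words K L))
      ≡⟨ sum-map-distribˡ (allowed a x (toℕ y)) (weightAfter a (toℕ y)) (words K L) ⟩
    allowed a x (toℕ y) * sum (map (weightAfter a (toℕ y)) (words K L))
      ≡⟨ cong (allowed a x (toℕ y) *_) (sum-weightAfter a K L (toℕ y)) ⟩
    allowed a x (toℕ y) * wordsAfter a K L (toℕ y) ∎

countP₂≡wordsAfter : ∀ a K L → countP₂ a K L ≡ wordsAfter a K L a
countP₂≡wordsAfter a K L = begin
  length (filter (P₂? a) (words K L))      ≡⟨ length-filter≡sum-𝟙 (P₂? a) (words K L) ⟩
  sum (map (𝟙 ∘ P₂? a) (words K L))        ≡⟨ sum-map-cong (𝟙-P₂? a) (words K L) ⟩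
  sum (map (weightAfter a a) (words K L))  ≡⟨ sum-weightAfter a K L a ⟩
  wordsAfter a K L a                       ∎

wordsAfter-cong : ∀ a K {x x′} → (∀ y → y < K → allowed a x y ≡ allowed a x′ y) →
  ∀ L → wordsAfter a K L x ≡ wordsAfter a K L x′
wordsAfter-cong a K eq zero    = refl
wordsAfter-cong a K eq (suc L) = sumTo-cong K (λ y y<K → cong (_* wordsAfter a K L y) (eq y y<K))

wordsAfter-outside : ∀ a K L {x} → a ≤ x → wordsAfter a K L x ≡ wordsAfter a K L a
wordsAfter-outside a K L a≤x =
  wordsAfter-cong a K (λ y _ → trans (allowed-outsideˡ a y a≤x) (sym (allowed-outsideˡ a y ≤-refl))) L

∑-wordsAfter-suc : ∀ a K L x (h : ℕ → ℕ) →
  ∑[ y < K ] (allowed a x y * ∑[ i < L ] (wordsAfter a K i y * h i))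
    ≡ ∑[ i < L ] (wordsAfter a K (suc i) x * h i)
∑-wordsAfter-suc a K L x h = begin
  ∑[ y < K ] (allowed a x y * ∑[ i < L ] (wordsAfter a K i y * h i))
    ≡⟨ sumTo-cong K (λ y _ → sumTo-distribˡ L (allowed a x y) _) ⟨
  ∑[ y < K ] ∑[ i < L ] (allowed a x y * (wordsAfter a K i y * h i))
    ≡⟨ sumTo-comm K L (λ y i → allowed a x y * (wordsAfter a K i y * h i)) ⟩
  ∑[ i < L ] ∑[ y < K ] (allowed a x y * (wordsAfter a K i y * h i))
    ≡⟨ sumTo-cong L (λ i _ → sumTo-cong K (λ y _ → *-assoc (allowed a x y) _ (h i))) ⟨
  ∑[ i < L ] ∑[ y < K ] (allowed a x y * wordsAfter a K i y * h i)
    ≡⟨ sumTo-cong L (λ i _ → sumTo-distribʳ K (h i) _) ⟩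
  ∑[ i < L ] (wordsAfter a K (suc i) x * h i) ∎

-- Decomposition at the first occurrence of the new letter K ≥ a.
wordsAfter-suc-alphabet : ∀ a K → a ≤ K → ∀ L x →
  wordsAfter a (suc K) L x
    ≡ wordsAfter a K L x + ∑[ i < L ] (wordsAfter a K i x * wordsAfter a (suc K) (L ∸ suc i) a)
wordsAfter-suc-alphabet a K a≤K zero    x = refl
wordsAfter-suc-alphabet a K a≤K (suc L) x = begin
  ∑[ y < suc K ] (allowed a x y * W′ L y)
    ≡⟨ sumTo-snoc K _ ⟩
  ∑[ y < K ] (allowed a x y * W′ L y) + allowed a x K * W′ L K
    ≡⟨ cong₂ _+_ (sumTo-cong K (λ y _ → cong (allowed a x y *_) (wordsAfter-suc-alphabet a K a≤K L y)))
                 new-letter-first ⟩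
  ∑[ y < K ] (allowed a x y * (W L y + S y)) + W′ L a
    ≡⟨ cong (_+ W′ L a) (trans (sumTo-cong K (λ y _ → *-distribˡ-+ (allowed a x y) (W L y) (S y)))
                               (sumTo-distrib-+ K _ _)) ⟩
  W (suc L) x + ∑[ y < K ] (allowed a x y * S y) + W′ L a
    ≡⟨ cong (λ z → W (suc L) x + z + W′ L a) (∑-wordsAfter-suc a K L x (λ i → W′ (L ∸ suc i) a)) ⟩
  W (suc L) x + T + W′ L a
    ≡⟨ +-assoc (W (suc L) x) T (W′ L a) ⟩
  W (suc L) x + (T + W′ L a)
    ≡⟨ cong (W (suc L) x +_) (trans (+-comm T (W′ L a)) (cong (_+ T) (sym (*-identityˡ (W′ L a))))) ⟩
  W (suc L) x + (1 * W′ L a + T) ∎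
  where
  W W′ : ℕ → ℕ → ℕ
  W  = wordsAfter a K
  W′ = wordsAfter a (suc K)
  S : ℕ → ℕ
  S y = ∑[ i < L ] (W i y * W′ (L ∸ suc i) a)
  T : ℕ
  T = ∑[ i < L ] (W (suc i) x * W′ (L ∸ suc i) a)
  new-letter-first : allowed a x K * W′ L K ≡ W′ L a
  new-letter-first = trans (cong₂ _*_ (allowed-outsideʳ a x a≤K) (wordsAfter-outside a (suc K) L a≤K))
                           (*-identityˡ _)

wordsAfter-renewal : ∀ a K → a ≤ K →
  IsRenewal (λ L → wordsAfter a K L a) (λ L → wordsAfter a (suc K) L a)
wordsAfter-renewal a K a≤K L = wordsAfter-suc-alphabet a K a≤K L a

-- Non-increasing words

hockey-stick : ∀ L x → ∑[ y < suc x ] ((L + y) C y) ≡ (suc L + x) C x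
hockey-stick L zero    = refl
hockey-stick L (suc x) = begin
  ∑[ y < suc (suc x) ] ((L + y) C y)           ≡⟨ sumTo-snoc (suc x) (λ y → (L + y) C y) ⟩
  ∑[ y < suc x ] ((L + y) C y) + (L + suc x) C suc x
                                               ≡⟨ cong (_+ (L + suc x) C suc x) (hockey-stick L x) ⟩
  (suc L + x) C x + (L + suc x) C suc x        ≡⟨ cong (λ n → n C x + (L + suc x) C suc x) (+-suc L x) ⟨
  (L + suc x) C x + (L + suc x) C suc x        ≡⟨ nCk+nC[k+1]≡[n+1]C[k+1] (L + suc x) x ⟩
  suc (L + suc x) C suc x                      ∎

wordsAfter-nonincreasing : ∀ b L {x} → x ≤ b → wordsAfter (suc b) (suc b) L x ≡ (L + x) C x
wordsAfter-nonincreasing b zero    {x} x≤b = sym (nCn≡1 x)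
wordsAfter-nonincreasing b (suc L) {x} x≤b = begin
  sumTo (suc b) term                                  ≡⟨ cong (λ n → sumTo n term) (m+[n∸m]≡n (s≤s x≤b)) ⟨
  sumTo (suc x + (b ∸ x)) term                        ≡⟨ sumTo-split (suc x) (b ∸ x) term ⟩
  sumTo (suc x) term + ∑[ i < b ∸ x ] term (suc x + i) ≡⟨ cong₂ _+_ (sumTo-cong (suc x) descents)
                                                                  (sumTo-zero (b ∸ x) rises) ⟩
  ∑[ y < suc x ] ((L + y) C y) + 0                    ≡⟨ +-identityʳ _ ⟩
  ∑[ y < suc x ] ((L + y) C y)                        ≡⟨ hockey-stick L x ⟩
  (suc L + x) C x                                     ∎
  where
  term : ℕ → ℕ
  term y = allowed (suc b) x y * wordsAfter (suc b) (suc b) L y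
  descents : ∀ y → y < suc x → term y ≡ (L + y) C y
  descents y (s≤s y≤x) =
    trans (cong₂ _*_ (allowed-descent (suc b) y≤x) (wordsAfter-nonincreasing b L (≤-trans y≤x x≤b)))
          (*-identityˡ _)
  rises : ∀ i → i < b ∸ x → term (suc x + i) ≡ 0
  rises i i<b∸x = cong (_* wordsAfter (suc b) (suc b) L (suc x + i))
    (allowed-rise (s≤s x≤b) (s≤s x+i<b) (s≤s (m≤m+n x i)))
    where
    x+i<b : x + i < b
    x+i<b = <-≤-trans (+-monoʳ-< x i<b∸x) (≤-reflexive (m+[n∸m]≡n x≤b))

f₀≡wordsAfter : ∀ b L → f₀ (suc b) (suc L) ≡ wordsAfter (suc b) (suc b) L (suc b)
f₀≡wordsAfter b L = begin
  f₀ (suc b) (suc L)                         ≡⟨ cong (λ n → (n ∸ 1) C b) (+-suc L b) ⟩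
  (L + b) C b                                ≡⟨ wordsAfter-nonincreasing b L ≤-refl ⟨
  wordsAfter (suc b) (suc b) L b             ≡⟨ wordsAfter-cong (suc b) (suc b) same-row L ⟩
  wordsAfter (suc b) (suc b) L (suc b)       ∎
  where
  same-row : ∀ y → y < suc b → allowed (suc b) b y ≡ allowed (suc b) (suc b) y
  same-row y (s≤s y≤b) = trans (allowed-descent (suc b) y≤b) (sym (allowed-outsideˡ (suc b) y ≤-refl))

f≡wordsAfter : ∀ b m L → f (f₀ (suc b)) m (suc L) ≡ wordsAfter (suc b) (suc b + m) L (suc b)
f≡wordsAfter b zero    L = trans (f₀≡wordsAfter b L) (cong (λ K → wordsAfter a K L a) (sym (+-identityʳ a)))
  where a = suc b
f≡wordsAfter b (suc m) L = begin
  f (f₀ a) (suc m) (suc L)            ≡⟨ f-suc (f₀ a) m (suc L) ⟩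
  compositionSum (f (f₀ a) m) (suc L) ≡⟨ renewal-unique (f≡wordsAfter b m)
                                           (compositionSum-renewal (f (f₀ a) m))
                                           (wordsAfter-renewal a (a + m) (m≤m+n a m)) L ⟩
  wordsAfter a (suc (a + m)) L a      ≡⟨ cong (λ K → wordsAfter a K L a) (+-suc a m) ⟨
  wordsAfter a (a + suc m) L a        ∎
  where a = suc b

mainTheorem7 : (a m : ℕ) → 1 ≤ a → 1 ≤ m → (n : ℕ) → 1 ≤ n →
  f (f₀ a) m n ≡ countP₂ a (a + m) (n ∸ 1)
mainTheorem7 (suc b) m _ _ (suc L) _ =
  trans (f≡wordsAfter b m L) (sym (countP₂≡wordsAfter (suc b) (suc b + m) L))
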